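{- Let $G=(V,E)$ be a graph and let $X\subseteq V$ be a non-empty module of $G$. Let $G'$ be the graph obtained from $G$ by deleting $X$ and adding a clique $X'$ on $\Gamma(G[X])$ new vertices, where every vertex of $X'$ is made adjacent to every vertex of $V\setminus X$ that has a neighbor in $X$. Then $\Gamma(G)=\Gamma(G')$.
   Context: A module of $G$ is a set $X\subseteq V$ such that every vertex of $V\setminus X$ is adjacent either to all vertices of $X$ or to none. A $k$-Grundy coloring of a graph $(V,E)$ is a partition of $V$ into $k$ non-empty independent sets $V_1,\ldots,V_k$ such that for each $i\in[k-1]$ every vertex of $\bigcup_{j>i}V_j$ has a neighbor in $V_i$; $\Gamma(G)$ is the maximum such $k$. -}

module Defs where

open import Data.Nat using (ℕ; _≤_)
open import Data.Fin using (Fin; _<_)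
open import Data.Fin.Subset using (Subset; _∈_; _∉_)
open import Data.Bool using (Bool; true; false)
open import Data.Product using (Σ; ∃; ∃-syntax; _×_; _,_; proj₁)
open import Data.Sum using (_⊎_; inj₁; inj₂)
open import Relation.Nullary using (¬_)
open import Relation.Binary.PropositionalEquality using (_≡_; _≢_)
open import Function using (Surjective)
open import Function.Bundles using (_⇔_)

record FinGraph (n : ℕ) : Set where
  field
    adj     : Fin n → Fin n → Bool
    adj-sym : ∀ u v → adj u v ≡ adj v u
    adj-irr : ∀ v → adj v v ≡ false

open FinGraph public

Edge : ∀ {n} → FinGraph n → Fin n → Fin n → Set
Edge G u v = adj G u v ≡ true

-- k-Grundy coloring of a graph with vertex type V and adjacency E.
-- c v is the (0-based) index of the class containing v; V_i = c⁻¹(i).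
record GrundyColoring (V : Set) (E : V → V → Set) (k : ℕ) : Set where
  field
    col         : V → Fin k
    surjective  : ∀ (i : Fin k) → ∃[ v ] col v ≡ i
    independent : ∀ u v → E u v → col u ≢ col v
    grundy      : ∀ v (i : Fin k) → i < col v → ∃[ u ] (E v u × col u ≡ i)

IsGrundyNumber : (V : Set) → (V → V → Set) → ℕ → Set
IsGrundyNumber V E k =
  GrundyColoring V E k × (∀ (j : ℕ) → GrundyColoring V E j → j ≤ k)

IsModule : ∀ {n} → FinGraph n → Subset n → Set
IsModule G X = ∀ v → v ∉ X →
  (∀ x → x ∈ X → Edge G v x) ⊎ (∀ x → x ∈ X → ¬ Edge G v x)

InducedV : ∀ {n} → Subset n → Set
InducedV X = Σ (Fin _) (λ v → v ∈ X)

InducedE : ∀ {n} (G : FinGraph n) (X : Subset n) → InducedV X → InducedV X → Set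
InducedE G X u v = Edge G (proj₁ u) (proj₁ v)

ReplV : ∀ {n} → Subset n → ℕ → Set
ReplV X m = Σ (Fin _) (λ v → v ∉ X) ⊎ Fin m

ReplE : ∀ {n} (G : FinGraph n) (X : Subset n) (m : ℕ) → ReplV X m → ReplV X m → Set
ReplE G X m (inj₁ u) (inj₁ v) = Edge G (proj₁ u) (proj₁ v)
ReplE G X m (inj₁ u) (inj₂ j) = ∃[ x ] (x ∈ X × Edge G (proj₁ u) x)
ReplE G X m (inj₂ i) (inj₁ v) = ∃[ x ] (x ∈ X × Edge G (proj₁ v) x)
ReplE G X m (inj₂ i) (inj₂ j) = i ≢ j

-- A Grundy coloring of G uses some set S of colors on the module X. Ranking S turns its
-- restriction into a Grundy coloring of G[X], so |S| ≤ Γ(G[X]); giving |S| clique vertices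
-- the colors of S is a Grundy coloring of G' with the same colors, and the remaining clique
-- vertices are added greedily, which loses no color. Hence Γ(G) ≤ Γ(G'). Conversely the
-- clique of G' carries Γ(G[X]) distinct colors T, and recoloring X by an optimal coloring
-- of G[X] followed by the order isomorphism onto T is a Grundy coloring of G with as many
-- colors. Both transfers work because a vertex outside X sees all of X or none of it.

module Submission where

open import Defs
open import Data.Nat using (ℕ; zero; suc; _+_; _∸_; _≤_; _<_; z≤n; s≤s) renaming (_≟_ to _≟ℕ_; _<?_ to _<ℕ?_)
open import Data.Nat.Properties
  using (≤-refl; ≤-trans; ≤-antisym; ≤-pred; <-trans; <-≤-trans; <-irrefl; <-cmp; <⇒≤; <⇒≢; >⇒≢; <⇒≱; ≮⇒≥;
         n≤1+n; n<1+n; m≤n⇒m≤1+n; m<n⇒m<1+n; m≤n⇒m<n∨m≡n; m<1+n⇒m<n∨m≡n; m∸n+n≡m)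
open import Data.Fin using (Fin; zero; suc; toℕ; fromℕ<)
open import Data.Fin.Properties using (suc-injective; toℕ-injective; toℕ-fromℕ<; toℕ<n; any?; injective⇒≤) renaming (_≟_ to _≟F_)
open import Function.Definitions using (Injective)
open import Data.Bool using (true) renaming (_≟_ to _≟B_)
open import Data.Fin.Subset using (Subset; _∈_; _∉_)
open import Data.Fin.Subset.Properties using (_∈?_)
open import Relation.Nullary.Decidable using (_×-dec_; toSum)
open import Data.Product using (Σ; ∃-syntax; _×_; _,_; proj₁; proj₂)
open import Data.Sum using (_⊎_; inj₁; inj₂; [_,_]′)
open import Data.Unit using (⊤; tt)
open import Data.Empty using (⊥)
open import Relation.Nullary using (¬_; Dec; yes; no; contradiction)
open import Relation.Unary using (Decidable)
open import Relation.Binary using (tri<; tri≈; tri>)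
open import Relation.Binary.PropositionalEquality
  using (_≡_; _≢_; refl; sym; trans; cong; subst; subst₂; module ≡-Reasoning)
open import Function.Bundles using (_⇔_; mk⇔)
open import Function using (_∘_)

record IsGrundy {V : Set} (E : V → V → Set) (k : ℕ) (c : V → ℕ) : Set where
  field
    bounded : ∀ v → c v < k
    onto    : ∀ i → i < k → ∃[ v ] c v ≡ i
    proper  : ∀ u v → E u v → c u ≢ c v
    grundy  : ∀ v i → i < c v → ∃[ u ] (E v u × c u ≡ i)

module _ {V : Set} {E : V → V → Set} {k : ℕ} where

  toIsGrundy : (C : GrundyColoring V E k) → IsGrundy E k (toℕ ∘ GrundyColoring.col C)
  toIsGrundy C = record
    { bounded = λ v → toℕ<n (col v)
    ; onto    = λ i i<k → let v , cv≡i = surjective (fromℕ< i<k) in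
                  v , trans (cong toℕ cv≡i) (toℕ-fromℕ< i<k)
    ; proper  = λ u v e eq → independent u v e (toℕ-injective eq)
    ; grundy  = λ v i i<cv →
                  let u , e , cu≡i = grundy v (fromℕ< (<-trans i<cv (toℕ<n (col v))))
                                       (subst (_< toℕ (col v)) (sym (toℕ-fromℕ< _)) i<cv) in
                  u , e , trans (cong toℕ cu≡i) (toℕ-fromℕ< _)
    }
    where open GrundyColoring C

  module _ {c : V → ℕ} (C : IsGrundy E k c) where
    open IsGrundy C

    fromIsGrundy : GrundyColoring V E k
    fromIsGrundy = record
      { col         = col
      ; surjective  = λ i → let v , cv≡i = onto (toℕ i) (toℕ<n i) in
                        v , toℕ-injective (trans (toℕ-col v) cv≡i)
      ; independent = λ u v e eq →
                        proper u v e (trans (sym (toℕ-col u)) (trans (cong toℕ eq) (toℕ-col v)))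
      ; grundy      = λ v i i<cv →
                        let u , e , cu≡i = grundy v (toℕ i) (subst (toℕ i <_) (toℕ-col v) i<cv) in
                        u , e , toℕ-injective (trans (toℕ-col u) cu≡i)
      }
      where
      col : V → Fin k
      col v = fromℕ< (bounded v)
      toℕ-col : ∀ v → toℕ (col v) ≡ c v
      toℕ-col v = toℕ-fromℕ< (bounded v)

    twins⇒sameColor : ∀ {u u'} → (∀ w → E u w → E u' w) → (∀ w → E u' w → E u w) → c u ≡ c u'
    twins⇒sameColor {u} {u'} u⊆u' u'⊆u with <-cmp (c u) (c u')
    ... | tri≈ _ eq _ = eq
    ... | tri< cu<cu' _ _ =
          let w , e , cw≡cu = grundy u' (c u) cu<cu' in contradiction (sym cw≡cu) (proper u w (u'⊆u w e))
    ... | tri> _ _ cu'<cu =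
          let w , e , cw≡cu' = grundy u (c u') cu'<cu in contradiction (sym cw≡cu') (proper u' w (u⊆u' w e))

IsGrundy-pullback : ∀ {V W : Set} {E : V → V → Set} {F : W → W → Set} {k c} (ψ : W → V) →
  (∀ v → ∃[ w ] ψ w ≡ v) → (∀ a b → F a b → E (ψ a) (ψ b)) → (∀ a b → E (ψ a) (ψ b) → F a b) →
  IsGrundy E k c → IsGrundy F k (c ∘ ψ)
IsGrundy-pullback {E = E} {c = c} ψ ψ-onto preserves reflects C = record
  { bounded = λ w → bounded (ψ w)
  ; onto    = λ i i<k → let v , cv≡i = onto i i<k ; w , ψw≡v = ψ-onto v in
                w , trans (cong c ψw≡v) cv≡i
  ; proper  = λ a b e → proper (ψ a) (ψ b) (preserves a b e)
  ; grundy  = λ a i i<c → let v , e , cv≡i = grundy (ψ a) i i<c ; b , ψb≡v = ψ-onto v in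
                b , reflects a b (subst (E (ψ a)) (sym ψb≡v) e) , trans (cong c ψb≡v) cv≡i
  }
  where open IsGrundy C

first-failure : ∀ {P : ℕ → Set} → Decidable P → ∀ k →
  (∀ j → j < k → P j) ⊎ ∃[ i ] (i < k × ¬ P i × (∀ j → j < i → P j))
first-failure P? zero = inj₁ λ _ ()
first-failure P? (suc k) with first-failure P? k
... | inj₂ (i , i<k , ¬Pi , below) = inj₂ (i , m<n⇒m<1+n i<k , ¬Pi , below)
... | inj₁ below with P? k
...   | no ¬Pk = inj₂ (k , n<1+n k , ¬Pk , below)
...   | yes Pk = inj₁ λ j j<1+k → [ below j , (λ { refl → Pk }) ]′ (m<1+n⇒m<n∨m≡n j<1+k)

WithVertex : ∀ {V : Set} → (V → V → Set) → (V → Set) → V ⊎ ⊤ → V ⊎ ⊤ → Set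
WithVertex E N (inj₁ u) (inj₁ v) = E u v
WithVertex E N (inj₁ u) (inj₂ _) = N u
WithVertex E N (inj₂ _) (inj₁ v) = N v
WithVertex E N (inj₂ _) (inj₂ _) = ⊥

module _ {V : Set} {E : V → V → Set} {N : V → Set} {k : ℕ} {c : V → ℕ} (C : IsGrundy E k c) where
  open IsGrundy C

  private
    NeighbourColored : ℕ → Set
    NeighbourColored i = ∃[ u ] (N u × c u ≡ i)

    -- i is either an old color (K = k) or a fresh one (K = suc k).
    withColor : ∀ i K → i < K → k ≤ K → (∀ j → j < K → j < k ⊎ j ≡ i) →
      ¬ NeighbourColored i → (∀ j → j < i → NeighbourColored j) →
      IsGrundy (WithVertex E N) K [ c , (λ _ → i) ]′
    withColor i K i<K k≤K covered ¬Ni below = record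
      { bounded = λ { (inj₁ v) → <-≤-trans (bounded v) k≤K ; (inj₂ _) → i<K }
      ; onto    = λ j j<K → [ (λ j<k → let v , cv≡j = onto j j<k in inj₁ v , cv≡j)
                            , (λ j≡i → inj₂ tt , sym j≡i) ]′ (covered j j<K)
      ; proper  = λ { (inj₁ u) (inj₁ v) e → proper u v e
                    ; (inj₁ u) (inj₂ _) Nu cu≡i → ¬Ni (u , Nu , cu≡i)
                    ; (inj₂ _) (inj₁ v) Nv i≡cv → ¬Ni (v , Nv , sym i≡cv)
                    ; (inj₂ _) (inj₂ _) () }
      ; grundy  = λ { (inj₁ v) j j<cv → let u , e , cu≡j = grundy v j j<cv in inj₁ u , e , cu≡j
                    ; (inj₂ _) j j<i → let u , Nu , cu≡j = below j j<i in inj₁ u , Nu , cu≡j }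
      }

  -- The new vertex takes the least color missing from its neighbourhood.
  IsGrundy-withVertex : (∀ i → Dec (∃[ u ] (N u × c u ≡ i))) →
    ∃[ K ] (k ≤ K × ∃[ c⁺ ] IsGrundy (WithVertex E N) K c⁺)
  IsGrundy-withVertex N? with first-failure N? k
  ... | inj₂ (i , i<k , ¬Ni , below) = k , ≤-refl , _ , withColor i k i<k ≤-refl (λ j j<k → inj₁ j<k) ¬Ni below
  ... | inj₁ below = suc k , n≤1+n k , _ ,
          withColor k (suc k) (n<1+n k) (n≤1+n k) (λ j → m<1+n⇒m<n∨m≡n)
            (λ { (u , _ , cu≡k) → <-irrefl cu≡k (bounded u) }) below

module Rank {P : ℕ → Set} (P? : Decidable P) where

  rank : ℕ → ℕ
  rank zero = zero
  rank (suc i) with P? i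
  ... | yes _ = suc (rank i)
  ... | no _  = rank i

  -- The r-th element of P below K; a junk value when r ≥ rank K.
  unrank : ℕ → ℕ → ℕ
  unrank zero    r = zero
  unrank (suc K) r with r <ℕ? rank K
  ... | yes _ = unrank K r
  ... | no _  = K

  rank-mono : ∀ {i j} → i ≤ j → rank i ≤ rank j
  rank-mono {j = zero} z≤n = ≤-refl
  rank-mono {i} {suc j} i≤1+j with m≤n⇒m<n∨m≡n i≤1+j
  ... | inj₂ refl = ≤-refl
  ... | inj₁ (s≤s i≤j) with P? j
  ...   | yes _ = m≤n⇒m≤1+n (rank-mono i≤j)
  ...   | no _  = rank-mono i≤j

  rank-< : ∀ {i j} → P i → i < j → rank i < rank j
  rank-< {i} Pi i<j = ≤-trans (step i Pi) (rank-mono i<j)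
    where
    step : ∀ i → P i → suc (rank i) ≤ rank (suc i)
    step i Pi with P? i
    ... | yes _  = ≤-refl
    ... | no ¬Pi = contradiction Pi ¬Pi

  rank-cancel-< : ∀ {i j} → rank i < rank j → i < j
  rank-cancel-< {i} {j} ri<rj with i <ℕ? j
  ... | yes i<j = i<j
  ... | no i≮j  = contradiction (rank-mono (≮⇒≥ i≮j)) (<⇒≱ ri<rj)

  rank-injective : ∀ {i j} → P i → P j → rank i ≡ rank j → i ≡ j
  rank-injective {i} {j} Pi Pj ri≡rj with <-cmp i j
  ... | tri< i<j _ _ = contradiction ri≡rj (<⇒≢ (rank-< Pi i<j))
  ... | tri≈ _ i≡j _ = i≡j
  ... | tri> _ _ j<i = contradiction ri≡rj (>⇒≢ (rank-< Pj j<i))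

  unrank-spec : ∀ K r → r < rank K → unrank K r < K × P (unrank K r) × rank (unrank K r) ≡ r
  unrank-spec (suc K) r r<rank with r <ℕ? rank K
  ... | yes r<rankK = let u<K , Pu , ru≡r = unrank-spec K r r<rankK in m<n⇒m<1+n u<K , Pu , ru≡r
  ... | no r≮rankK with P? K
  ...   | yes PK  = n<1+n K , PK , ≤-antisym (≮⇒≥ r≮rankK) (≤-pred r<rank)
  ...   | no _    = contradiction r<rank r≮rankK

  unrank-rank : ∀ {i K} → P i → i < K → unrank K (rank i) ≡ i
  unrank-rank {i} {K} Pi i<K =
    let _ , Pu , ru≡ri = unrank-spec K (rank i) (rank-< Pi i<K) in rank-injective Pu Pi ru≡ri

module _ {m : ℕ} (a : Fin m → ℕ) where

  InImage : ℕ → Set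
  InImage i = ∃[ j ] a j ≡ i

  InImage? : Decidable InImage
  InImage? i = any? (λ j → a j ≟ℕ i)

  open Rank InImage?

  rank-image : ∀ {K} → Injective _≡_ _≡_ a → (∀ j → a j < K) → rank K ≡ m
  rank-image {K} a-inj a<K = ≤-antisym (injective⇒≤ {f = preimage} preimage-injective)
                                        (injective⇒≤ {f = rankOf} rankOf-injective)
    where
    rankOf : Fin m → Fin (rank K)
    rankOf j = fromℕ< (rank-< (j , refl) (a<K j))
    rankOf-injective : Injective _≡_ _≡_ rankOf
    rankOf-injective {j} {j'} eq = a-inj (rank-injective (j , refl) (j' , refl)
      (trans (sym (toℕ-fromℕ< _)) (trans (cong toℕ eq) (toℕ-fromℕ< _))))
    preimage : Fin (rank K) → Fin m
    preimage r = proj₁ (proj₁ (proj₂ (unrank-spec K (toℕ r) (toℕ<n r))))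
    preimage-injective : Injective _≡_ _≡_ preimage
    preimage-injective {r} {r'} eq with unrank-spec K (toℕ r) (toℕ<n r) | unrank-spec K (toℕ r') (toℕ<n r')
    ... | _ , (j , aj≡u) , ru≡r | _ , (j' , aj'≡u') , ru'≡r' = toℕ-injective (begin
      toℕ r                     ≡⟨ ru≡r ⟨
      rank (unrank K (toℕ r))   ≡⟨ cong rank (trans (sym aj≡u) (trans (cong a eq) aj'≡u')) ⟩
      rank (unrank K (toℕ r'))  ≡⟨ ru'≡r' ⟩
      toℕ r'                    ∎)
      where open ≡-Reasoning

IsGrundyNumber-transfer : ∀ {V W : Set} {E : V → V → Set} {F : W → W → Set} →
  (∀ {k} → GrundyColoring V E k → ∃[ K ] (k ≤ K × GrundyColoring W F K)) →
  (∀ {k} → GrundyColoring W F k → GrundyColoring V E k) →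
  ∀ k → IsGrundyNumber V E k ⇔ IsGrundyNumber W F k
IsGrundyNumber-transfer {V} {W} {E} {F} grow shrink k = mk⇔ to from
  where
  to : IsGrundyNumber V E k → IsGrundyNumber W F k
  to (C , maximal) =
    let K , k≤K , C⁺ = grow C in
    subst (GrundyColoring W F) (≤-antisym (maximal K (shrink C⁺)) k≤K) C⁺ ,
    λ j Cj → maximal j (shrink Cj)
  from : IsGrundyNumber W F k → IsGrundyNumber V E k
  from (C , maximal) = shrink C ,
    λ j Cj → let K , j≤K , C⁺ = grow Cj in ≤-trans j≤K (maximal K C⁺)

Edge-sym : ∀ {n} (G : FinGraph n) {u v} → Edge G u v → Edge G v u
Edge-sym G {u} {v} e = trans (adj-sym G v u) e

Edge? : ∀ {n} (G : FinGraph n) u v → Dec (Edge G u v)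
Edge? G u v = adj G u v ≟B true

module _ {n : ℕ} (G : FinGraph n) (X : Subset n) where

  AdjacentToX : Fin n → Set
  AdjacentToX v = ∃[ x ] (x ∈ X × Edge G v x)

  AdjacentToX? : Decidable AdjacentToX
  AdjacentToX? v = any? (λ x → (x ∈? X) ×-dec Edge? G v x)

  -- A Grundy color cannot depend on the proof of v ∉ X, which is not unique definitionally.
  color-irrelevant : ∀ {t k c} → IsGrundy (ReplE G X t) k c →
    ∀ {v} (q q' : v ∉ X) → c (inj₁ (v , q)) ≡ c (inj₁ (v , q'))
  color-irrelevant C q q' = twins⇒sameColor C (sameEdges q q') (sameEdges q' q)
    where
    sameEdges : ∀ {t v} (q q' : v ∉ X) w → ReplE G X t (inj₁ (v , q)) w → ReplE G X t (inj₁ (v , q')) w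
    sameEdges q q' (inj₁ _) e = e
    sameEdges q q' (inj₂ _) e = e

  NewCliqueNeighbour : ∀ {t} → ReplV X t → Set
  NewCliqueNeighbour (inj₁ (v , _)) = AdjacentToX v
  NewCliqueNeighbour (inj₂ _)       = ⊤

  private
    outsideColored? : ∀ {t k c} → IsGrundy (ReplE G X t) k c →
      ∀ i v → Dec (Σ (v ∉ X) λ q → AdjacentToX v × c (inj₁ (v , q)) ≡ i)
    outsideColored? {c = c} C i v with v ∈? X
    ... | yes v∈X = no λ (v∉X , _) → v∉X v∈X
    ... | no v∉X with AdjacentToX? v ×-dec (c (inj₁ (v , v∉X)) ≟ℕ i)
    ...   | yes (adjX , cv≡i) = yes (v∉X , adjX , cv≡i)
    ...   | no ¬colored = no λ (q , adjX , cv≡i) →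
              ¬colored (adjX , trans (color-irrelevant C v∉X q) cv≡i)

  newCliqueNeighbourColored? : ∀ {t k c} → IsGrundy (ReplE G X t) k c →
    ∀ i → Dec (∃[ u ] (NewCliqueNeighbour u × c u ≡ i))
  newCliqueNeighbourColored? {c = c} C i with any? (outsideColored? C i) | any? (λ j → c (inj₂ j) ≟ℕ i)
  ... | yes (v , q , adjX , cv≡i) | _ = yes (inj₁ (v , q) , adjX , cv≡i)
  ... | no _ | yes (j , cj≡i) = yes (inj₂ j , tt , cj≡i)
  ... | no ¬outside | no ¬clique = no λ
        { (inj₁ (v , q) , adjX , cv≡i) → ¬outside (v , q , adjX , cv≡i)
        ; (inj₂ j , _ , cj≡i)          → ¬clique (j , cj≡i) }

  IsGrundy-growClique : ∀ {t k c} → IsGrundy (ReplE G X t) k c →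
    ∃[ K ] (k ≤ K × ∃[ c⁺ ] IsGrundy (ReplE G X (suc t)) K c⁺)
  IsGrundy-growClique {t} C =
    let K , k≤K , _ , C⁺ = IsGrundy-withVertex C (newCliqueNeighbourColored? C) in
    K , k≤K , _ , IsGrundy-pullback split split-onto preserves reflects C⁺
    where
    split : ReplV X (suc t) → ReplV X t ⊎ ⊤
    split (inj₁ v)       = inj₁ (inj₁ v)
    split (inj₂ zero)    = inj₂ tt
    split (inj₂ (suc j)) = inj₁ (inj₂ j)

    split-onto : ∀ w → ∃[ u ] split u ≡ w
    split-onto (inj₁ (inj₁ v)) = inj₁ v , refl
    split-onto (inj₁ (inj₂ j)) = inj₂ (suc j) , refl
    split-onto (inj₂ tt)       = inj₂ zero , refl

    E⁺ : ReplV X t ⊎ ⊤ → ReplV X t ⊎ ⊤ → Set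
    E⁺ = WithVertex (ReplE G X t) NewCliqueNeighbour

    preserves : ∀ a b → ReplE G X (suc t) a b → E⁺ (split a) (split b)
    preserves (inj₁ _)       (inj₁ _)       e = e
    preserves (inj₁ _)       (inj₂ zero)    e = e
    preserves (inj₁ _)       (inj₂ (suc _)) e = e
    preserves (inj₂ zero)    (inj₁ _)       e = e
    preserves (inj₂ zero)    (inj₂ zero)    e = e refl
    preserves (inj₂ zero)    (inj₂ (suc _)) e = tt
    preserves (inj₂ (suc _)) (inj₁ _)       e = e
    preserves (inj₂ (suc _)) (inj₂ zero)    e = tt
    preserves (inj₂ (suc _)) (inj₂ (suc _)) e = λ i≡j → e (cong suc i≡j)

    reflects : ∀ a b → E⁺ (split a) (split b) → ReplE G X (suc t) a b
    reflects (inj₁ _)       (inj₁ _)       e = e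
    reflects (inj₁ _)       (inj₂ zero)    e = e
    reflects (inj₁ _)       (inj₂ (suc _)) e = e
    reflects (inj₂ zero)    (inj₁ _)       e = e
    reflects (inj₂ zero)    (inj₂ zero)    ()
    reflects (inj₂ zero)    (inj₂ (suc _)) _ = λ ()
    reflects (inj₂ (suc _)) (inj₁ _)       e = e
    reflects (inj₂ (suc _)) (inj₂ zero)    _ = λ ()
    reflects (inj₂ (suc _)) (inj₂ (suc _)) e = λ si≡sj → e (suc-injective si≡sj)

  IsGrundy-growCliqueBy : ∀ d {t k c} → IsGrundy (ReplE G X t) k c →
    ∃[ K ] (k ≤ K × ∃[ c⁺ ] IsGrundy (ReplE G X (d + t)) K c⁺)
  IsGrundy-growCliqueBy zero    C = _ , ≤-refl , _ , C
  IsGrundy-growCliqueBy (suc d) C =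
    let K , k≤K , _ , C⁺ = IsGrundy-growCliqueBy d C
        K' , K≤K' , _ , C⁺⁺ = IsGrundy-growClique C⁺ in
    K' , ≤-trans k≤K K≤K' , _ , C⁺⁺

  module _ (isModule : IsModule G X) where

    module-adjacent : ∀ {v x y} → v ∉ X → x ∈ X → Edge G v x → y ∈ X → Edge G v y
    module-adjacent {v} {x} v∉X x∈X e y∈X with isModule v v∉X
    ... | inj₁ toAll  = toAll _ y∈X
    ... | inj₂ toNone = contradiction e (toNone x x∈X)

    module _ {k : ℕ} {c : Fin n → ℕ} (C : IsGrundy (Edge G) k c) where
      open IsGrundy C

      ColorOfX : ℕ → Set
      ColorOfX i = ∃[ x ] (x ∈ X × c x ≡ i)

      ColorOfX? : Decidable ColorOfX
      ColorOfX? i = any? (λ x → (x ∈? X) ×-dec (c x ≟ℕ i))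

      open Rank ColorOfX?

      colorRestricted : InducedV X → ℕ
      colorRestricted (x , _) = rank (c x)

      -- A color below that of x ∈ X which is used on X must be seen inside X:
      -- an outside neighbour of x would be adjacent to the whole module.
      IsGrundy-restrict : IsGrundy (InducedE G X) (rank k) colorRestricted
      IsGrundy-restrict = record
        { bounded = λ (x , x∈X) → rank-< (x , x∈X , refl) (bounded x)
        ; onto    = onto′
        ; proper  = λ (x , x∈X) (y , y∈X) e eq →
                      proper x y e (rank-injective (x , x∈X , refl) (y , y∈X , refl) eq)
        ; grundy  = grundy′
        }
        where
        onto′ : ∀ r → r < rank k → ∃[ v ] colorRestricted v ≡ r
        onto′ r r<rk = let _ , (y , y∈X , cy≡u) , ru≡r = unrank-spec k r r<rk in
                       (y , y∈X) , trans (cong rank cy≡u) ru≡r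

        grundy′ : ∀ v r → r < colorRestricted v →
                  ∃[ u ] (InducedE G X v u × colorRestricted u ≡ r)
        grundy′ (x , x∈X) r r<rcx with unrank-spec k r (<-≤-trans r<rcx (rank-mono (<⇒≤ (bounded x))))
        ... | _ , (y , y∈X , cy≡u) , ru≡r
          with grundy x (unrank k r) (rank-cancel-< (subst (_< rank (c x)) (sym ru≡r) r<rcx))
        ...   | w , e , cw≡u with w ∈? X
        ...     | yes w∈X = (w , w∈X) , e , trans (cong rank cw≡u) ru≡r
        ...     | no w∉X  = contradiction (trans cw≡u (sym cy≡u))
                              (proper w y (module-adjacent w∉X x∈X (Edge-sym G e) y∈X))

      colorReplaced : ReplV X (rank k) → ℕ
      colorReplaced (inj₁ (v , _)) = c v
      colorReplaced (inj₂ j)       = unrank k (toℕ j)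

      private
        cliqueSpec : ∀ j → unrank k (toℕ j) < k × ColorOfX (unrank k (toℕ j)) × rank (unrank k (toℕ j)) ≡ toℕ j
        cliqueSpec j = unrank-spec k (toℕ j) (toℕ<n j)

        cliqueVertexColored : ∀ {i} → ColorOfX i → i < k →
          Σ (Fin (rank k)) λ j → toℕ j ≡ rank i × colorReplaced (inj₂ j) ≡ i
        cliqueVertexColored {i} Xi i<k = j , toℕ-fromℕ< _ ,
          trans (cong (unrank k) (toℕ-fromℕ< _)) (unrank-rank Xi i<k)
          where
          j : Fin (rank k)
          j = fromℕ< (rank-< Xi i<k)

      IsGrundy-replace : IsGrundy (ReplE G X (rank k)) k colorReplaced
      IsGrundy-replace = record
        { bounded = λ { (inj₁ (v , _)) → bounded v ; (inj₂ j) → proj₁ (cliqueSpec j) }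
        ; onto    = onto′
        ; proper  = proper′
        ; grundy  = grundy′
        }
        where
        onto′ : ∀ i → i < k → ∃[ u ] colorReplaced u ≡ i
        onto′ i i<k with onto i i<k
        ... | v , cv≡i with v ∈? X
        ...   | no v∉X  = inj₁ (v , v∉X) , cv≡i
        ...   | yes v∈X = let j , _ , cj≡i = cliqueVertexColored (v , v∈X , cv≡i) i<k in inj₂ j , cj≡i

        outside≢clique : ∀ {v} (v∉X : v ∉ X) j → ReplE G X (rank k) (inj₁ (v , v∉X)) (inj₂ j) →
                         c v ≢ unrank k (toℕ j)
        outside≢clique v∉X j (x , x∈X , e) cv≡cj =
          let _ , (y , y∈X , cy≡cj) , _ = cliqueSpec j in
          proper _ y (module-adjacent v∉X x∈X e y∈X) (trans cv≡cj (sym cy≡cj))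

        proper′ : ∀ u w → ReplE G X (rank k) u w → colorReplaced u ≢ colorReplaced w
        proper′ (inj₁ (u , _))   (inj₁ (w , _))   e     = proper u w e
        proper′ (inj₁ (v , v∉X)) (inj₂ j)         e     = outside≢clique v∉X j e
        proper′ (inj₂ j)         (inj₁ (v , v∉X)) e     = outside≢clique v∉X j e ∘ sym
        proper′ (inj₂ j)         (inj₂ j')        j≢j' eq = j≢j' (toℕ-injective (begin
          toℕ j                       ≡⟨ proj₂ (proj₂ (cliqueSpec j)) ⟨
          rank (unrank k (toℕ j))     ≡⟨ cong rank eq ⟩
          rank (unrank k (toℕ j'))    ≡⟨ proj₂ (proj₂ (cliqueSpec j')) ⟩
          toℕ j'                      ∎))
          where open ≡-Reasoning

        grundy′ : ∀ u i → i < colorReplaced u →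
                  ∃[ w ] (ReplE G X (rank k) u w × colorReplaced w ≡ i)
        grundy′ (inj₁ (v , _)) i i<cv with grundy v i i<cv
        ... | w , e , cw≡i with w ∈? X
        ...   | no w∉X  = inj₁ (w , w∉X) , e , cw≡i
        ...   | yes w∈X = let j , _ , cj≡i = cliqueVertexColored (w , w∈X , cw≡i) (<-trans i<cv (bounded v)) in
                          inj₂ j , (w , w∈X , e) , cj≡i
        grundy′ (inj₂ j) i i<cj with cliqueSpec j
        ... | cj<k , (y , y∈X , cy≡cj) , rcj≡j with grundy y i (subst (i <_) (sym cy≡cj) i<cj)
        ...   | w , e , cw≡i with w ∈? X
        ...     | no w∉X  = inj₁ (w , w∉X) , (y , y∈X , Edge-sym G e) , cw≡i
        ...     | yes w∈X =
                  let Xi = (w , w∈X , cw≡i)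
                      j' , j'≡ri , cj'≡i = cliqueVertexColored Xi (<-trans i<cj cj<k)
                      j'<j : toℕ j' < toℕ j
                      j'<j = subst₂ _<_ (sym j'≡ri) rcj≡j (rank-< Xi i<cj) in
                  inj₂ j' , (λ j≡j' → <-irrefl (cong toℕ (sym j≡j')) j'<j) , cj'≡i

    module _ {m J : ℕ} {g : InducedV X → ℕ} {c : ReplV X m → ℕ}
             (CX : IsGrundy (InducedE G X) m g) (C : IsGrundy (ReplE G X m) J c) where
      open IsGrundy C

      cliqueColor : Fin m → ℕ
      cliqueColor j = c (inj₂ j)

      cliqueColor-injective : Injective _≡_ _≡_ cliqueColor
      cliqueColor-injective {j} {j'} eq with j ≟F j'
      ... | yes j≡j' = j≡j'
      ... | no j≢j'  = contradiction eq (proper (inj₂ j) (inj₂ j') j≢j')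

      open Rank (InImage? cliqueColor)

      rankJ≡m : rank J ≡ m
      rankJ≡m = rank-image cliqueColor cliqueColor-injective (λ j → bounded (inj₂ j))

      -- So unrank J is an order isomorphism from the colors of G[X] onto the clique colors.
      unrank-clique : ∀ {r} → r < m → unrank J r < J × InImage cliqueColor (unrank J r) × rank (unrank J r) ≡ r
      unrank-clique {r} r<m = unrank-spec J r (subst (r <_) (sym rankJ≡m) r<m)

      colorSubstituted : Fin n → ℕ
      colorSubstituted v with v ∈? X
      ... | yes v∈X = unrank J (g (v , v∈X))
      ... | no v∉X  = c (inj₁ (v , v∉X))

      colorSubstituted-inside : ∀ {v} (v∈X : v ∈ X) → colorSubstituted v ≡ unrank J (g (v , v∈X))
      colorSubstituted-inside {v} v∈X with v ∈? X
      ... | yes v∈X′ = cong (unrank J) (twins⇒sameColor CX (λ _ e → e) (λ _ e → e))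
      ... | no v∉X   = contradiction v∈X v∉X

      colorSubstituted-outside : ∀ {v} (v∉X : v ∉ X) → colorSubstituted v ≡ c (inj₁ (v , v∉X))
      colorSubstituted-outside {v} v∉X with v ∈? X
      ... | yes v∈X  = contradiction v∈X v∉X
      ... | no v∉X′  = color-irrelevant C v∉X′ v∉X

      private
        module CX = IsGrundy CX

        insideVertexColored : ∀ {i} → InImage cliqueColor i → i < J →
          ∃[ x ] (x ∈ X × colorSubstituted x ≡ i)
        insideVertexColored {i} Ti i<J =
          let (x , x∈X) , gx≡ri = CX.onto (rank i) (subst (rank i <_) rankJ≡m (rank-< Ti i<J)) in
          x , x∈X , (begin
            colorSubstituted x        ≡⟨ colorSubstituted-inside x∈X ⟩
            unrank J (g (x , x∈X))    ≡⟨ cong (unrank J) gx≡ri ⟩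
            unrank J (rank i)         ≡⟨ unrank-rank Ti i<J ⟩
            i                         ∎)
          where open ≡-Reasoning

        outside≢inside : ∀ {v x} → v ∉ X → (x∈X : x ∈ X) → Edge G v x →
          colorSubstituted v ≢ colorSubstituted x
        outside≢inside {v} {x} v∉X x∈X e eq =
          let _ , (j , cj≡) , _ = unrank-clique (CX.bounded (x , x∈X)) in
          proper (inj₁ (v , v∉X)) (inj₂ j) (x , x∈X , e) (begin
            c (inj₁ (v , v∉X))        ≡⟨ colorSubstituted-outside v∉X ⟨
            colorSubstituted v        ≡⟨ eq ⟩
            colorSubstituted x        ≡⟨ colorSubstituted-inside x∈X ⟩
            unrank J (g (x , x∈X))    ≡⟨ cj≡ ⟨
            c (inj₂ j)                ∎)
          where open ≡-Reasoning

      IsGrundy-substitute : IsGrundy (Edge G) J colorSubstituted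
      IsGrundy-substitute = record
        { bounded = bounded′ ; onto = onto′ ; proper = proper′ ; grundy = grundy′ }
        where
        open ≡-Reasoning

        bounded′ : ∀ v → colorSubstituted v < J
        bounded′ v with toSum (v ∈? X)
        ... | inj₁ v∈X = subst (_< J) (sym (colorSubstituted-inside v∈X))
                          (proj₁ (unrank-clique (CX.bounded (v , v∈X))))
        ... | inj₂ v∉X = subst (_< J) (sym (colorSubstituted-outside v∉X)) (bounded (inj₁ (v , v∉X)))

        onto′ : ∀ i → i < J → ∃[ v ] colorSubstituted v ≡ i
        onto′ i i<J with onto i i<J
        ... | inj₁ (v , v∉X) , cv≡i = v , trans (colorSubstituted-outside v∉X) cv≡i
        ... | inj₂ j , cj≡i         = let x , _ , cx≡i = insideVertexColored (j , cj≡i) i<J in x , cx≡i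

        proper′ : ∀ u v → Edge G u v → colorSubstituted u ≢ colorSubstituted v
        proper′ u v e with toSum (u ∈? X) | toSum (v ∈? X)
        ... | inj₁ u∈X | inj₁ v∈X = λ eq → CX.proper (u , u∈X) (v , v∈X) e (begin
              g (u , u∈X)                         ≡⟨ proj₂ (proj₂ (unrank-clique (CX.bounded (u , u∈X)))) ⟨
              rank (unrank J (g (u , u∈X)))       ≡⟨ cong rank (trans (sym (colorSubstituted-inside u∈X))
                                                       (trans eq (colorSubstituted-inside v∈X))) ⟩
              rank (unrank J (g (v , v∈X)))       ≡⟨ proj₂ (proj₂ (unrank-clique (CX.bounded (v , v∈X)))) ⟩
              g (v , v∈X)                         ∎)
        ... | inj₁ u∈X | inj₂ v∉X = outside≢inside v∉X u∈X (Edge-sym G e) ∘ sym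
        ... | inj₂ u∉X | inj₁ v∈X = outside≢inside u∉X v∈X e
        ... | inj₂ u∉X | inj₂ v∉X = λ eq → proper (inj₁ (u , u∉X)) (inj₁ (v , v∉X)) e
              (trans (sym (colorSubstituted-outside u∉X)) (trans eq (colorSubstituted-outside v∉X)))

        grundy′ : ∀ v i → i < colorSubstituted v → ∃[ u ] (Edge G v u × colorSubstituted u ≡ i)
        grundy′ v i i<cv with toSum (v ∈? X)
        grundy′ v i i<cv | inj₂ v∉X
          with grundy (inj₁ (v , v∉X)) i (subst (i <_) (colorSubstituted-outside v∉X) i<cv)
        ... | inj₁ (u , u∉X) , e , cu≡i = u , e , trans (colorSubstituted-outside u∉X) cu≡i
        ... | inj₂ j , (x , x∈X , e) , cj≡i =
              let y , y∈X , cy≡i = insideVertexColored (j , cj≡i) (<-trans i<cv (bounded′ v)) in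
              y , module-adjacent v∉X x∈X e y∈X , cy≡i
        grundy′ v i i<cv | inj₁ v∈X with unrank-clique (CX.bounded (v , v∈X))
        ... | _ , (j , cj≡cv) , rcv≡gv with InImage? cliqueColor i
        ...   | yes Ti =
                let i<cv′ = subst (i <_) (colorSubstituted-inside v∈X) i<cv
                    (u , u∈X) , e , gu≡ri = CX.grundy (v , v∈X) (rank i) (subst (rank i <_) rcv≡gv (rank-< Ti i<cv′)) in
                u , e , (begin
                  colorSubstituted u       ≡⟨ colorSubstituted-inside u∈X ⟩
                  unrank J (g (u , u∈X))   ≡⟨ cong (unrank J) gu≡ri ⟩
                  unrank J (rank i)        ≡⟨ unrank-rank Ti (<-trans i<cv (bounded′ v)) ⟩
                  i                        ∎)
        ...   | no ¬Ti
          with grundy (inj₂ j) i (subst (i <_) (trans (colorSubstituted-inside v∈X) (sym cj≡cv)) i<cv)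
        ...     | inj₂ j′ , _ , cj′≡i = contradiction (j′ , cj′≡i) ¬Ti
        ...     | inj₁ (u , u∉X) , (x , x∈X , e) , cu≡i =
                  u , Edge-sym G (module-adjacent u∉X x∈X e v∈X) , trans (colorSubstituted-outside u∉X) cu≡i

    GrundyColoring-replace : ∀ {m} → (∀ j → GrundyColoring (InducedV X) (InducedE G X) j → j ≤ m) →
      ∀ {k} → GrundyColoring (Fin n) (Edge G) k → ∃[ K ] (k ≤ K × GrundyColoring (ReplV X m) (ReplE G X m) K)
    GrundyColoring-replace {m} maximal {k} Ck =
      let C = toIsGrundy Ck
          s = Rank.rank (ColorOfX? C) k
          s≤m = maximal s (fromIsGrundy (IsGrundy-restrict C))
          K , k≤K , _ , C⁺ = IsGrundy-growCliqueBy (m ∸ s) (IsGrundy-replace C)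
      in K , k≤K , subst (λ t → GrundyColoring (ReplV X t) (ReplE G X t) K) (m∸n+n≡m s≤m) (fromIsGrundy C⁺)

    GrundyColoring-substitute : ∀ {m} → GrundyColoring (InducedV X) (InducedE G X) m →
      ∀ {J} → GrundyColoring (ReplV X m) (ReplE G X m) J → GrundyColoring (Fin n) (Edge G) J
    GrundyColoring-substitute CX C = fromIsGrundy (IsGrundy-substitute (toIsGrundy CX) (toIsGrundy C))

lemma6p6 : ∀ (n : ℕ) (G : FinGraph n) (X : Subset n) →
    ∃[ x ] x ∈ X →
    IsModule G X →
    ∀ (m : ℕ) → IsGrundyNumber (InducedV X) (InducedE G X) m →
    ∀ (k : ℕ) → IsGrundyNumber (Fin n) (Edge G) k ⇔ IsGrundyNumber (ReplV X m) (ReplE G X m) k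
lemma6p6 n G X _ isModule m (CX , maximal) =
  IsGrundyNumber-transfer (GrundyColoring-replace G X isModule maximal)
                          (GrundyColoring-substitute G X isModule CX)
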